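{- Let $\mathcal{M}$ be the set of Motzkin meanders that contain neither $DU$ nor $UH$ as a contiguous subword, and let $S(u)=\sum_{w\in\mathcal{M}} z^{|w|}u^{\mathrm{level}(w)}$. Put $$W=\sqrt{(1-z)(1-z-2z^2-2z^3+z^4-z^5)},\qquad r_1=\frac{1-z+z^2-z^3-W}{2z(1-z)}.$$ Then $$S(u)=\frac{r_1-z}{z^2(1-u(1-z)r_1)},$$ and for every $j\ge1$ the generating function of the meanders in $\mathcal{M}$ ending at level $j$ is $[u^j]S(u)=\frac{(1-z)^jr_1^{j+1}}{z^2}-\frac{(1-z)^jr_1^{j}}{z}$.
   Context: A Motzkin meander is a finite word $w$ over $\{U,H,D\}$ (heights $+1,0,-1$) all of whose prefixes have nonnegative height sum; $|w|$ is its length and $\mathrm{level}(w)$ its total height sum; the empty word is included; excursions are meanders of level $0$. "Contains $XY$ as a contiguous subword" means two consecutive letters are $X$ then $Y$. Generating functions are formal power series in $z$; $W$ is the formal power series square root with constant term $1$; $[u^j]$ is coefficient extraction. -}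

module Defs where

open import Data.Nat as ℕ using (ℕ; zero; suc; _∸_)
open import Data.Integer as ℤ using (ℤ)
open import Data.Rational as ℚ using (ℚ; 0ℚ; 1ℚ)
open import Data.Bool using (Bool; true; false; not; _∧_; _∨_)
open import Data.List using (List; []; _∷_; concatMap; filterᵇ; length)
open import Data.Maybe using (Maybe; just; nothing)
open import Relation.Binary.PropositionalEquality using (_≡_)

ℕ→ℚ : ℕ → ℚ
ℕ→ℚ n = ℤ.+ n ℚ./ 1

ℤ→ℚ : ℤ → ℚ
ℤ→ℚ k = k ℚ./ 1

-- Formal power series in z over ℚ:  f n = [z^n] f

Series : Set
Series = ℕ → ℚ

infix 4 _≐_
_≐_ : Series → Series → Set
f ≐ g = ∀ n → f n ≡ g n

Σ≤ : ℕ → (ℕ → ℚ) → ℚ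
Σ≤ zero f = f 0
Σ≤ (suc n) f = Σ≤ n f ℚ.+ f (suc n)

infixl 6 _⊕_ _⊖_
infixl 7 _⊛_
infixr 8 _^ₛ_

_⊕_ : Series → Series → Series
(f ⊕ g) n = f n ℚ.+ g n

_⊖_ : Series → Series → Series
(f ⊖ g) n = f n ℚ.- g n

_⊛_ : Series → Series → Series
(f ⊛ g) n = Σ≤ n (λ k → f k ℚ.* g (n ∸ k))

-- polynomial given by its integer coefficient list [c0, c1, c2, ...]
poly : List ℤ → Series
poly [] _ = 0ℚ
poly (c ∷ cs) zero = ℤ→ℚ c
poly (c ∷ cs) (suc n) = poly cs n

one : Series
one = poly (ℤ.+ 1 ∷ [])

Z : Series
Z = poly (ℤ.+ 0 ∷ ℤ.+ 1 ∷ [])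

_^ₛ_ : Series → ℕ → Series
f ^ₛ zero = one
f ^ₛ suc k = f ⊛ (f ^ₛ k)

-- Bivariate formal power series in z,u:  F n j = [z^n u^j] F

Series₂ : Set
Series₂ = ℕ → ℕ → ℚ

infix 4 _≐₂_
_≐₂_ : Series₂ → Series₂ → Set
F ≐₂ G = ∀ n j → F n j ≡ G n j

infixl 6 _⊖₂_
infixl 7 _⊛₂_

_⊖₂_ : Series₂ → Series₂ → Series₂
(F ⊖₂ G) n j = F n j ℚ.- G n j

_⊛₂_ : Series₂ → Series₂ → Series₂
(F ⊛₂ G) n j = Σ≤ n (λ a → Σ≤ j (λ b → F a b ℚ.* G (n ∸ a) (j ∸ b)))

lift : Series → Series₂
lift f n zero = f n
lift f n (suc j) = 0ℚ

Uvar : Series₂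
Uvar zero (suc zero) = 1ℚ
Uvar _ _ = 0ℚ

coeffU : ℕ → Series₂ → Series
coeffU j F n = F n j

data Step : Set where
  U H D : Step

allWords : ℕ → List (List Step)
allWords zero = [] ∷ []
allWords (suc n) = concatMap (λ w → (U ∷ w) ∷ (H ∷ w) ∷ (D ∷ w) ∷ []) (allWords n)

heightFrom : ℕ → List Step → Maybe ℕ
heightFrom h [] = just h
heightFrom h (U ∷ w) = heightFrom (suc h) w
heightFrom h (H ∷ w) = heightFrom h w
heightFrom zero (D ∷ w) = nothing
heightFrom (suc h) (D ∷ w) = heightFrom h w

isMeanderOfLevel : ℕ → List Step → Bool
isMeanderOfLevel j w with heightFrom 0 w
... | nothing = false
... | just l = l ℕ.≡ᵇ j

stepEq : Step → Step → Bool
stepEq U U = true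
stepEq H H = true
stepEq D D = true
stepEq _ _ = false

containsPair : Step → Step → List Step → Bool
containsPair X Y [] = false
containsPair X Y (a ∷ []) = false
containsPair X Y (a ∷ b ∷ w) = (stepEq a X ∧ stepEq b Y) ∨ containsPair X Y (b ∷ w)

inMOfLevel : ℕ → List Step → Bool
inMOfLevel j w = isMeanderOfLevel j w ∧ not (containsPair D U w) ∧ not (containsPair U H w)

countM : ℕ → ℕ → ℕ
countM n j = length (filterᵇ (inMOfLevel j) (allWords n))

S : Series₂
S n j = ℕ→ℚ (countM n j)

oneMinusZ : Series
oneMinusZ = poly (ℤ.+ 1 ∷ ℤ.- ℤ.+ 1 ∷ [])

radicand : Series
radicand = oneMinusZ ⊛ poly (ℤ.+ 1 ∷ ℤ.- ℤ.+ 1 ∷ ℤ.- ℤ.+ 2 ∷ ℤ.- ℤ.+ 2 ∷ ℤ.+ 1 ∷ ℤ.- ℤ.+ 1 ∷ [])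

IsW : Series → Set
IsW W = (W 0 ≡ 1ℚ) × (W ⊛ W ≐ radicand)
  where open import Data.Product using (_×_)

-- r₁ = (1 - z + z² - z³ - W) / (2z(1-z)), i.e. 2z(1-z) r₁ = 1 - z + z² - z³ - W
-- (2z(1-z) is a non-zero-divisor in ℚ[[z]], so this determines r₁)
IsR1 : Series → Series → Set
IsR1 W r₁ = poly (ℤ.+ 0 ∷ ℤ.+ 2 ∷ []) ⊛ oneMinusZ ⊛ r₁
            ≐ poly (ℤ.+ 1 ∷ ℤ.- ℤ.+ 1 ∷ ℤ.+ 1 ∷ ℤ.- ℤ.+ 1 ∷ []) ⊖ W

{-# OPTIONS --safe #-}
module Submission where

-- Clearing denominators, IsR1 reads W = 1 - z + z² - z³ - 2z(1-z) r₁, and then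
-- W² = (1-z)(1-z-2z²-2z³+z⁴-z⁵) + 4z(1-z) Q(r₁) with Q(r) = z(1-z) r² - (1-z)(1+z²) r + z.
-- So the hypotheses say exactly that r₁ is a root of Q; a root exists, its coefficients being
-- determined one at a time by r = z/(1-z) + z r² - z² r.
-- Classify the words of 𝓜 by level j and last letter. As the forbidden factors DU and UH have
-- length two, deleting the last letter gives linear recurrences: a word ending in U (resp. H, D)
-- extends a word of level j - 1 (resp. j, j + 1) not ending in D (resp. not ending in U, arbitrary).
-- With q = (1-z) r₁ and E = (r₁ - z)/z², explicit series in z, q and E satisfy the same
-- recurrences as a consequence of Q(r₁) = 0; hence [u^j] S = E q^j, which is both claims.

open import Defs
open import Data.Nat as ℕ using (ℕ; zero; suc; _+_; _∸_; _≤_; _≥_; z≤n; s≤s)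
import Data.Nat.Properties as ℕP
open import Data.Integer as ℤ using (ℤ)
open import Data.Rational as ℚ using (ℚ; 0ℚ; 1ℚ)
import Data.Rational.Properties as ℚP
import Data.Integer.Properties as ℤP
import Data.Nat.Coprimality as Cop
open import Data.Sign using (Sign)
import Data.Rational.Solver as ℚSolver
open import Data.List using (List; []; _∷_; _∷ʳ_; concatMap; filterᵇ; length)
open import Data.Maybe using (Maybe; just; nothing)
open import Data.Product using (_×_; _,_; ∃)
open import Data.Sum using (inj₁; inj₂)
open import Data.Bool using (Bool; true; false; not; _∧_; _∨_; if_then_else_)
import Data.Bool.Properties as BP
open import Relation.Nullary using (yes; no)
open import Relation.Binary.PropositionalEquality
open import Algebra.Bundles using (CommutativeRing)
open import Algebra.Structures using (IsCommutativeRing)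
import Algebra.Solver.Ring.AlmostCommutativeRing as ACR

open import Data.Nat.Solver using (module +-*-Solver)

open +-*-Solver using () renaming (solve to ℕ-solve; _:=_ to _n=_; _:+_ to _n+_)
open ℚSolver.+-*-Solver using ()
  renaming (solve to ℚ-solve; _:=_ to _q=_; _:+_ to _q+_; _:*_ to _q*_; :-_ to q-_)

Σ≤-cong : ∀ n {f g : ℕ → ℚ} → (∀ k → k ≤ n → f k ≡ g k) → Σ≤ n f ≡ Σ≤ n g
Σ≤-cong zero e = e 0 z≤n
Σ≤-cong (suc n) e =
  cong₂ ℚ._+_ (Σ≤-cong n (λ k k≤n → e k (ℕP.m≤n⇒m≤1+n k≤n))) (e (suc n) ℕP.≤-refl)

Σ≤-cong′ : ∀ n {f g : ℕ → ℚ} → (∀ k → f k ≡ g k) → Σ≤ n f ≡ Σ≤ n g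
Σ≤-cong′ n e = Σ≤-cong n (λ k _ → e k)

Σ≤-suc : ∀ n (f : ℕ → ℚ) → Σ≤ (suc n) f ≡ f 0 ℚ.+ Σ≤ n (λ k → f (suc k))
Σ≤-suc zero f = refl
Σ≤-suc (suc n) f = trans (cong (ℚ._+ f (suc (suc n))) (Σ≤-suc n f)) (ℚP.+-assoc (f 0) _ _)

Σ≤-distrib-+ : ∀ n (f g : ℕ → ℚ) → Σ≤ n (λ k → f k ℚ.+ g k) ≡ Σ≤ n f ℚ.+ Σ≤ n g
Σ≤-distrib-+ zero f g = refl
Σ≤-distrib-+ (suc n) f g =
  trans (cong (ℚ._+ (f (suc n) ℚ.+ g (suc n))) (Σ≤-distrib-+ n f g))
        (interchange (Σ≤ n f) (Σ≤ n g) (f (suc n)) (g (suc n)))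
  where
  interchange : ∀ a b c d → (a ℚ.+ b) ℚ.+ (c ℚ.+ d) ≡ (a ℚ.+ c) ℚ.+ (b ℚ.+ d)
  interchange = ℚ-solve 4 (λ a b c d → (a q+ b) q+ (c q+ d) q= (a q+ c) q+ (b q+ d)) refl

*-distribˡ-Σ≤ : ∀ n c (f : ℕ → ℚ) → c ℚ.* Σ≤ n f ≡ Σ≤ n (λ k → c ℚ.* f k)
*-distribˡ-Σ≤ zero c f = refl
*-distribˡ-Σ≤ (suc n) c f =
  trans (ℚP.*-distribˡ-+ c _ _) (cong (ℚ._+ (c ℚ.* f (suc n))) (*-distribˡ-Σ≤ n c f))

Σ≤-zero : ∀ n (f : ℕ → ℚ) → (∀ k → f k ≡ 0ℚ) → Σ≤ n f ≡ 0ℚ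
Σ≤-zero zero f e = e 0
Σ≤-zero (suc n) f e = trans (cong₂ ℚ._+_ (Σ≤-zero n f e) (e (suc n))) (ℚP.+-identityˡ 0ℚ)

Σ≤-head : ∀ n (f : ℕ → ℚ) → (∀ k → f (suc k) ≡ 0ℚ) → Σ≤ n f ≡ f 0
Σ≤-head zero f e = refl
Σ≤-head (suc n) f e = trans (cong₂ ℚ._+_ (Σ≤-head n f e) (e n)) (ℚP.+-identityʳ (f 0))

Σ≤-reverse : ∀ n (f : ℕ → ℚ) → Σ≤ n f ≡ Σ≤ n (λ k → f (n ∸ k))
Σ≤-reverse zero f = refl
Σ≤-reverse (suc n) f =
  trans (cong (ℚ._+ f (suc n)) (Σ≤-reverse n f))
        (trans (ℚP.+-comm (Σ≤ n (λ k → f (n ∸ k))) (f (suc n)))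
               (sym (Σ≤-suc n (λ k → f (suc n ∸ k)))))

-- The ring of power series

0ₛ : Series
0ₛ _ = 0ℚ

infix 8 -ₛ_
-ₛ_ : Series → Series
(-ₛ f) n = ℚ.- f n

shiftˡ : Series → Series
shiftˡ f k = f (suc k)

≐-sym : ∀ {f g} → f ≐ g → g ≐ f
≐-sym e n = sym (e n)

≐-trans : ∀ {f g h} → f ≐ g → g ≐ h → f ≐ h
≐-trans e e′ n = trans (e n) (e′ n)

⊕-cong : ∀ {f f′ g g′} → f ≐ f′ → g ≐ g′ → f ⊕ g ≐ f′ ⊕ g′
⊕-cong e e′ n = cong₂ ℚ._+_ (e n) (e′ n)

-ₛ-cong : ∀ {f f′} → f ≐ f′ → -ₛ f ≐ -ₛ f′
-ₛ-cong e n = cong ℚ.-_ (e n)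

⊛-cong : ∀ {f f′ g g′} → f ≐ f′ → g ≐ g′ → f ⊛ g ≐ f′ ⊛ g′
⊛-cong ef eg n = Σ≤-cong′ n (λ k → cong₂ ℚ._*_ (ef k) (eg (n ∸ k)))

⊛-local : ∀ n {f f′ g g′} → (∀ k → k ≤ n → f k ≡ f′ k) →
          (∀ k → k ≤ n → g k ≡ g′ k) → (f ⊛ g) n ≡ (f′ ⊛ g′) n
⊛-local n ef eg = Σ≤-cong n (λ k k≤n → cong₂ ℚ._*_ (ef k k≤n) (eg (n ∸ k) (ℕP.m∸n≤m n k)))

⊛-congˡ : ∀ f {g g′} → g ≐ g′ → f ⊛ g ≐ f ⊛ g′
⊛-congˡ f = ⊛-cong {f} (λ _ → refl)

⊛-comm : ∀ f g → f ⊛ g ≐ g ⊛ f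
⊛-comm f g n = trans (Σ≤-reverse n _) (Σ≤-cong n (λ k k≤n →
  trans (cong (λ i → f (n ∸ k) ℚ.* g i) (ℕP.m∸[m∸n]≡n k≤n)) (ℚP.*-comm (f (n ∸ k)) (g k))))

⊛-suc : ∀ f g n → (f ⊛ g) (suc n) ≡ f 0 ℚ.* g (suc n) ℚ.+ (shiftˡ f ⊛ g) n
⊛-suc f g n = Σ≤-suc n _

⊛-distribʳ-⊕ : ∀ h f g → (f ⊕ g) ⊛ h ≐ f ⊛ h ⊕ g ⊛ h
⊛-distribʳ-⊕ h f g n =
  trans (Σ≤-cong′ n (λ k → ℚP.*-distribʳ-+ (h (n ∸ k)) (f k) (g k))) (Σ≤-distrib-+ n _ _)

⊛-scaleˡ : ∀ c f g n → ((λ k → c ℚ.* f k) ⊛ g) n ≡ c ℚ.* (f ⊛ g) n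
⊛-scaleˡ c f g n =
  trans (Σ≤-cong′ n (λ k → ℚP.*-assoc c (f k) (g (n ∸ k)))) (sym (*-distribˡ-Σ≤ n c _))

⊛-assoc : ∀ f g h → (f ⊛ g) ⊛ h ≐ f ⊛ (g ⊛ h)
⊛-assoc f g h zero = ℚP.*-assoc (f 0) (g 0) (h 0)
⊛-assoc f g h (suc n) = begin
  ((f ⊛ g) ⊛ h) (suc n)
    ≡⟨ ⊛-suc (f ⊛ g) h n ⟩
  (f 0 ℚ.* g 0) ℚ.* h (suc n) ℚ.+ (shiftˡ (f ⊛ g) ⊛ h) n
    ≡⟨ cong ((f 0 ℚ.* g 0) ℚ.* h (suc n) ℚ.+_) tail ⟩
  (f 0 ℚ.* g 0) ℚ.* h (suc n) ℚ.+ (f 0 ℚ.* (shiftˡ g ⊛ h) n ℚ.+ (shiftˡ f ⊛ (g ⊛ h)) n)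
    ≡⟨ regroup (f 0) (g 0) (h (suc n)) _ _ ⟩
  f 0 ℚ.* (g 0 ℚ.* h (suc n) ℚ.+ (shiftˡ g ⊛ h) n) ℚ.+ (shiftˡ f ⊛ (g ⊛ h)) n
    ≡⟨ cong (λ x → f 0 ℚ.* x ℚ.+ (shiftˡ f ⊛ (g ⊛ h)) n) (sym (⊛-suc g h n)) ⟩
  f 0 ℚ.* (g ⊛ h) (suc n) ℚ.+ (shiftˡ f ⊛ (g ⊛ h)) n
    ≡⟨ sym (⊛-suc f (g ⊛ h) n) ⟩
  (f ⊛ (g ⊛ h)) (suc n) ∎
  where
  open ≡-Reasoning
  regroup : ∀ a b c d e → (a ℚ.* b) ℚ.* c ℚ.+ (a ℚ.* d ℚ.+ e) ≡ a ℚ.* (b ℚ.* c ℚ.+ d) ℚ.+ e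
  regroup = ℚ-solve 5 (λ a b c d e →
    (a q* b) q* c q+ (a q* d q+ e) q= a q* (b q* c q+ d) q+ e) refl
  tail : (shiftˡ (f ⊛ g) ⊛ h) n ≡ f 0 ℚ.* (shiftˡ g ⊛ h) n ℚ.+ (shiftˡ f ⊛ (g ⊛ h)) n
  tail = trans (⊛-cong {g = h} (⊛-suc f g) (λ _ → refl) n)
         (trans (⊛-distribʳ-⊕ h (λ k → f 0 ℚ.* shiftˡ g k) (shiftˡ f ⊛ g) n)
                (cong₂ ℚ._+_ (⊛-scaleˡ (f 0) (shiftˡ g) h n) (⊛-assoc (shiftˡ f) g h n)))

⊛-zeroˡ : ∀ f → 0ₛ ⊛ f ≐ 0ₛ
⊛-zeroˡ f n = Σ≤-zero n _ (λ k → ℚP.*-zeroˡ (f (n ∸ k)))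

⊛-zeroʳ : ∀ f → f ⊛ 0ₛ ≐ 0ₛ
⊛-zeroʳ f n = Σ≤-zero n _ (λ k → ℚP.*-zeroʳ (f k))

⊛-identityˡ : ∀ f → one ⊛ f ≐ f
⊛-identityˡ f zero = ℚP.*-identityˡ (f 0)
⊛-identityˡ f (suc n) = trans (⊛-suc one f n)
  (trans (cong₂ ℚ._+_ (ℚP.*-identityˡ (f (suc n))) (⊛-zeroˡ f n)) (ℚP.+-identityʳ (f (suc n))))

Z⊛-zero : ∀ f → (Z ⊛ f) 0 ≡ 0ℚ
Z⊛-zero f = ℚP.*-zeroˡ (f 0)

Z⊛-suc : ∀ f n → (Z ⊛ f) (suc n) ≡ f n
Z⊛-suc f n = trans (⊛-suc Z f n)
  (trans (cong₂ ℚ._+_ (ℚP.*-zeroˡ (f (suc n))) (⊛-identityˡ f n)) (ℚP.+-identityˡ (f n)))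

shiftʳ : Series → Series
shiftʳ f zero = 0ℚ
shiftʳ f (suc n) = f n

Z⊛≐shiftʳ : ∀ f → Z ⊛ f ≐ shiftʳ f
Z⊛≐shiftʳ f zero = Z⊛-zero f
Z⊛≐shiftʳ f (suc n) = Z⊛-suc f n

series-isCommutativeRing : IsCommutativeRing _≐_ _⊕_ _⊛_ -ₛ_ 0ₛ one
series-isCommutativeRing = record
  { isRing = record
    { +-isAbelianGroup = record
      { isGroup = record
        { isMonoid = record
          { isSemigroup = record
            { isMagma = record
              { isEquivalence = record { refl = λ _ → refl ; sym = ≐-sym ; trans = ≐-trans }
              ; ∙-cong = λ {f} {f′} {g} {g′} → ⊕-cong {f} {f′} {g} {g′} }
            ; assoc = λ f g h n → ℚP.+-assoc (f n) (g n) (h n) }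
          ; identity = (λ f n → ℚP.+-identityˡ (f n)) , (λ f n → ℚP.+-identityʳ (f n)) }
        ; inverse = (λ f n → ℚP.+-inverseˡ (f n)) , (λ f n → ℚP.+-inverseʳ (f n))
        ; ⁻¹-cong = λ {f} {f′} → -ₛ-cong {f} {f′} }
      ; comm = λ f g n → ℚP.+-comm (f n) (g n) }
    ; *-cong = λ {f} {f′} {g} {g′} → ⊛-cong {f} {f′} {g} {g′}
    ; *-assoc = ⊛-assoc
    ; *-identity = ⊛-identityˡ , (λ f → ≐-trans (⊛-comm f one) (⊛-identityˡ f))
    ; distrib = (λ h f g → ≐-trans (⊛-comm h (f ⊕ g)) (≐-trans (⊛-distribʳ-⊕ h f g)
                   (λ n → cong₂ ℚ._+_ (⊛-comm f h n) (⊛-comm g h n))))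
              , ⊛-distribʳ-⊕ }
  ; *-comm = ⊛-comm }

series-commutativeRing : CommutativeRing _ _
series-commutativeRing = record { isCommutativeRing = series-isCommutativeRing }

constₛ : ℚ → Series
constₛ c zero = c
constₛ c (suc _) = 0ℚ

constₛ-homo-* : ∀ c d → constₛ (c ℚ.* d) ≐ constₛ c ⊛ constₛ d
constₛ-homo-* c d zero = refl
constₛ-homo-* c d (suc n) = sym (Σ≤-zero (suc n) _ λ
  { zero → ℚP.*-zeroʳ c
  ; (suc k) → ℚP.*-zeroˡ (constₛ d (suc n ∸ suc k)) })

constₛ-morphism : ACR._-Raw-AlmostCommutative⟶_ ℚ.+-*-rawRing
                    (ACR.fromCommutativeRing series-commutativeRing)
constₛ-morphism = record
  { ⟦_⟧ = constₛ
  ; +-homo = λ { c d zero → refl ; c d (suc n) → refl }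
  ; *-homo = constₛ-homo-*
  ; -‿homo = λ { c zero → refl ; c (suc n) → refl }
  ; 0-homo = λ { zero → refl ; (suc n) → refl }
  ; 1-homo = λ { zero → refl ; (suc n) → refl } }

constₛ-≟ : (c d : ℚ) → Maybe (constₛ c ≐ constₛ d)
constₛ-≟ c d with c ℚP.≟ d
... | yes refl = just (λ _ → refl)
... | no _ = nothing

open import Algebra.Solver.Ring ℚ.+-*-rawRing (ACR.fromCommutativeRing series-commutativeRing)
  constₛ-morphism constₛ-≟ using (solve; _:=_; _:+_; _:*_; _:-_; :-_; _:^_; con; Polynomial)

^ₛ-cong : ∀ {f g} j → f ≐ g → f ^ₛ j ≐ g ^ₛ j
^ₛ-cong zero e = λ _ → refl
^ₛ-cong (suc j) e = ⊛-cong e (^ₛ-cong j e)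

^ₛ-distrib-⊛ : ∀ f g j → (f ⊛ g) ^ₛ j ≐ f ^ₛ j ⊛ g ^ₛ j
^ₛ-distrib-⊛ f g zero = ≐-sym (⊛-identityˡ one)
^ₛ-distrib-⊛ f g (suc j) = ≐-trans (⊛-congˡ (f ⊛ g) (^ₛ-distrib-⊛ f g j))
  (solve 4 (λ a b x y → a :* b :* (x :* y) := a :* x :* (b :* y)) (λ _ → refl) f g (f ^ₛ j) (g ^ₛ j))

-- The solver denotes constants by constₛ c, which is only pointwise equal to one from Defs.
𝟙 : Series
𝟙 = constₛ 1ℚ

one≐𝟙 : one ≐ 𝟙
one≐𝟙 zero = refl
one≐𝟙 (suc n) = refl

𝟘 : Series
𝟘 = constₛ 0ℚ

𝟘≐0ₛ : 𝟘 ≐ 0ₛ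
𝟘≐0ₛ zero = refl
𝟘≐0ₛ (suc n) = refl

1-z : Series
1-z = 𝟙 ⊕ -ₛ Z

difference-zero : ∀ {f g} → f ≐ g → f ⊕ -ₛ g ≐ 0ₛ
difference-zero {g = g} e n = trans (cong (ℚ._+ ℚ.- g n) (e n)) (ℚP.+-inverseʳ (g n))

difference-zero⁻¹ : ∀ {f g} → f ⊕ -ₛ g ≐ 0ₛ → f ≐ g
difference-zero⁻¹ {f} {g} e n =
  trans (ℚ-solve 2 (λ a b → a q= (a q+ q- b) q+ b) refl (f n) (g n))
        (trans (cong (ℚ._+ g n) (e n)) (ℚP.+-identityˡ (g n)))

-- An identity L ≐ R is proved modulo series Xᵢ known to vanish: the ring solver checks
-- L = R + Σ Cᵢ Xᵢ.
≐-modulo₁ : ∀ {L R C X} → L ≐ R ⊕ C ⊛ X → X ≐ 0ₛ → L ≐ R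
≐-modulo₁ {R = R} {C} e X≐0 n =
  trans (e n) (trans (cong (R n ℚ.+_) (≐-trans (⊛-congˡ C X≐0) (⊛-zeroʳ C) n)) (ℚP.+-identityʳ (R n)))

≐-modulo₂ : ∀ {L R C₁ X₁ C₂ X₂} → L ≐ R ⊕ C₁ ⊛ X₁ ⊕ C₂ ⊛ X₂ →
            X₁ ≐ 0ₛ → X₂ ≐ 0ₛ → L ≐ R
≐-modulo₂ {C₁ = C₁} {X₁} {C₂} {X₂} e X₁≐0 X₂≐0 =
  ≐-modulo₁ {C = C₁} {X = X₁} (≐-modulo₁ {C = C₂} {X = X₂} e X₂≐0) X₁≐0

≐-modulo₃ : ∀ {L R C₁ X₁ C₂ X₂ C₃ X₃} → L ≐ R ⊕ C₁ ⊛ X₁ ⊕ C₂ ⊛ X₂ ⊕ C₃ ⊛ X₃ →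
            X₁ ≐ 0ₛ → X₂ ≐ 0ₛ → X₃ ≐ 0ₛ → L ≐ R
≐-modulo₃ {C₁ = C₁} {X₁} {C₂} {X₂} {C₃} {X₃} e X₁≐0 X₂≐0 X₃≐0 =
  ≐-modulo₂ {C₁ = C₁} {X₁} {C₂} {X₂} (≐-modulo₁ {C = C₃} {X = X₃} e X₃≐0) X₁≐0 X₂≐0

Z⊛-cancel : ∀ {f} → Z ⊛ f ≐ 0ₛ → f ≐ 0ₛ
Z⊛-cancel {f} e n = trans (sym (Z⊛-suc f n)) (e (suc n))

⊛-cancel-unit : ∀ {u v f} → u ⊛ v ≐ 𝟙 → u ⊛ f ≐ 0ₛ → f ≐ 0ₛ
⊛-cancel-unit {u} {v} {f} uv≐1 uf≐0 = ≐-trans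
  (≐-modulo₁ {C = -ₛ f} {X = u ⊛ v ⊕ -ₛ 𝟙}
    (solve 3 (λ u v f → f := v :* (u :* f) :+ (:- f) :* (u :* v :- con 1ℚ)) (λ _ → refl) u v f)
    (difference-zero uv≐1))
  (≐-trans (⊛-congˡ v uf≐0) (⊛-zeroʳ v))

geometric : Series
geometric _ = 1ℚ

constₛ-⊛ : ∀ c f n → (constₛ c ⊛ f) n ≡ c ℚ.* f n
constₛ-⊛ c f zero = refl
constₛ-⊛ c f (suc n) = trans (⊛-suc (constₛ c) f n)
  (trans (cong (c ℚ.* f (suc n) ℚ.+_) (⊛-zeroˡ f n)) (ℚP.+-identityʳ _))

1-z⊛geometric : 1-z ⊛ geometric ≐ 𝟙
1-z⊛geometric = ≐-trans
  (solve 2 (λ z g → (con 1ℚ :- z) :* g := con 1ℚ :* g :- z :* g) (λ _ → refl) Z geometric)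
  coefficients
  where
  coefficients : 𝟙 ⊛ geometric ⊕ -ₛ (Z ⊛ geometric) ≐ 𝟙
  coefficients zero = refl
  coefficients (suc n) =
    cong₂ (λ a b → a ℚ.+ ℚ.- b) (constₛ-⊛ 1ℚ geometric (suc n)) (Z⊛-suc geometric n)

4ℚ : ℚ
4ℚ = ℕ→ℚ 4

constₛ4-unit : constₛ 4ℚ ⊛ constₛ (ℚ.1/ 4ℚ) ≐ 𝟙
constₛ4-unit = ≐-sym (constₛ-homo-* 4ℚ (ℚ.1/ 4ℚ))

-- The quadratic equation of r₁

quadratic : Series → Series
quadratic r = Z ⊛ 1-z ⊛ r ⊛ r ⊕ -ₛ (1-z ⊛ (𝟙 ⊕ Z ⊛ Z) ⊛ r) ⊕ Z

IsRoot : Series → Set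
IsRoot r = quadratic r ≐ 0ₛ

horner : List ℤ → Series
horner [] = 𝟘
horner (c ∷ cs) = constₛ (ℤ→ℚ c) ⊕ Z ⊛ horner cs

hornerₚ : ∀ {k} → List ℤ → Polynomial k → Polynomial k
hornerₚ [] z = con 0ℚ
hornerₚ (c ∷ cs) z = con (ℤ→ℚ c) :+ z :* hornerₚ cs z

poly≐horner : ∀ cs → poly cs ≐ horner cs
poly≐horner [] zero = refl
poly≐horner [] (suc n) = refl
poly≐horner (c ∷ cs) zero =
  sym (trans (cong (ℤ→ℚ c ℚ.+_) (Z⊛-zero (horner cs))) (ℚP.+-identityʳ (ℤ→ℚ c)))
poly≐horner (c ∷ cs) (suc n) =
  trans (poly≐horner cs n)
        (sym (trans (cong (0ℚ ℚ.+_) (Z⊛-suc (horner cs) n)) (ℚP.+-identityˡ (horner cs n))))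

2z-coeffs 1-z-coeffs numerator-coeffs quintic-coeffs : List ℤ
2z-coeffs = ℤ.+ 0 ∷ ℤ.+ 2 ∷ []
1-z-coeffs = ℤ.+ 1 ∷ ℤ.- ℤ.+ 1 ∷ []
numerator-coeffs = ℤ.+ 1 ∷ ℤ.- ℤ.+ 1 ∷ ℤ.+ 1 ∷ ℤ.- ℤ.+ 1 ∷ []
quintic-coeffs = ℤ.+ 1 ∷ ℤ.- ℤ.+ 1 ∷ ℤ.- ℤ.+ 2 ∷ ℤ.- ℤ.+ 2 ∷ ℤ.+ 1 ∷ ℤ.- ℤ.+ 1 ∷ []

oneMinusZ≐1-z : oneMinusZ ≐ 1-z
oneMinusZ≐1-z = ≐-trans (poly≐horner 1-z-coeffs)
  (solve 1 (λ z → hornerₚ 1-z-coeffs z := con 1ℚ :- z) (λ _ → refl) Z)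

radicand≐horner : radicand ≐ horner 1-z-coeffs ⊛ horner quintic-coeffs
radicand≐horner = ⊛-cong (poly≐horner 1-z-coeffs) (poly≐horner quintic-coeffs)

-- IsR1 solved for W
candidateW : Series → Series
candidateW r = horner numerator-coeffs ⊕ -ₛ (horner 2z-coeffs ⊛ horner 1-z-coeffs ⊛ r)

-- W² is the discriminant of the quadratic, up to the factor 1 - z.
candidateW-square : ∀ r → candidateW r ⊛ candidateW r
  ≐ horner 1-z-coeffs ⊛ horner quintic-coeffs ⊕ (constₛ 4ℚ ⊛ Z ⊛ 1-z) ⊛ quadratic r
candidateW-square r = solve 2 (λ z r →
  let w = hornerₚ numerator-coeffs z :- hornerₚ 2z-coeffs z :* hornerₚ 1-z-coeffs z :* r
      o = con 1ℚ :- z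
  in w :* w := hornerₚ 1-z-coeffs z :* hornerₚ quintic-coeffs z
               :+ (con 4ℚ :* z :* o) :* (z :* o :* r :* r :- o :* (con 1ℚ :+ z :* z) :* r :+ z))
  (λ _ → refl) Z r

W≐candidateW : ∀ W r → IsR1 W r → W ≐ candidateW r
W≐candidateW W r hR n =
  trans (ℚ-solve 2 (λ w p → w q= p q+ q- (p q+ q- w)) refl (W n) (poly numerator-coeffs n))
        (cong₂ (λ a b → a ℚ.+ ℚ.- b) (poly≐horner numerator-coeffs n)
               (trans (sym (hR n)) (⊛-cong {g = r} (⊛-cong (poly≐horner 2z-coeffs)
                                                            (poly≐horner 1-z-coeffs)) (λ _ → refl) n)))

⊕-cancelˡ-zero : ∀ {A Y} → A ⊕ Y ≐ A → Y ≐ 0ₛ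
⊕-cancelˡ-zero {A} {Y} e n =
  trans (ℚ-solve 2 (λ a y → y q= (a q+ y) q+ q- a) refl (A n) (Y n))
        (trans (cong (ℚ._+ ℚ.- A n) (e n)) (ℚP.+-inverseʳ (A n)))

IsR1⇒IsRoot : ∀ W r → IsW W → IsR1 W r → IsRoot r
IsR1⇒IsRoot W r (_ , W²≐radicand) hR =
  ⊛-cancel-unit {u = constₛ 4ℚ} {constₛ (ℚ.1/ 4ℚ)} constₛ4-unit
    (⊛-cancel-unit {u = 1-z} {geometric} 1-z⊛geometric
      (Z⊛-cancel (≐-trans regroup (⊕-cancelˡ-zero (≐-trans (≐-sym (candidateW-square r)) W²)))))
  where
  W≐ : W ≐ candidateW r
  W≐ = W≐candidateW W r hR
  W² : candidateW r ⊛ candidateW r ≐ horner 1-z-coeffs ⊛ horner quintic-coeffs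
  W² = ≐-trans (⊛-cong (≐-sym W≐) (≐-sym W≐)) (≐-trans W²≐radicand radicand≐horner)
  regroup : Z ⊛ (1-z ⊛ (constₛ 4ℚ ⊛ quadratic r)) ≐ (constₛ 4ℚ ⊛ Z ⊛ 1-z) ⊛ quadratic r
  regroup = solve 2 (λ z q → z :* ((con 1ℚ :- z) :* (con 4ℚ :* q)) := con 4ℚ :* z :* (con 1ℚ :- z) :* q)
    (λ _ → refl) Z (quadratic r)

-- Coefficient n + 1 of z/(1-z) + z f² - z² f: it only involves f 0, …, f n.
nextCoeff : Series → ℕ → ℚ
nextCoeff f n = 1ℚ ℚ.+ (f ⊛ f) n ℚ.- (Z ⊛ f) n

approx : ℕ → Series
approx zero = 0ₛ
approx (suc m) k = if k ℕ.≡ᵇ suc m then nextCoeff (approx m) m else approx m k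

root : Series
root n = approx n n

≡ᵇ-refl : ∀ n → (n ℕ.≡ᵇ n) ≡ true
≡ᵇ-refl zero = refl
≡ᵇ-refl (suc n) = ≡ᵇ-refl n

<⇒≡ᵇ-false : ∀ k m → k ℕ.< m → (k ℕ.≡ᵇ m) ≡ false
<⇒≡ᵇ-false zero (suc m) _ = refl
<⇒≡ᵇ-false (suc k) (suc m) (s≤s k<m) = <⇒≡ᵇ-false k m k<m

approx≡root : ∀ m k → k ≤ m → approx m k ≡ root k
approx≡root zero zero z≤n = refl
approx≡root (suc m) k k≤1+m with ℕP.m≤n⇒m<n∨m≡n k≤1+m
... | inj₂ refl = refl
... | inj₁ k<1+m rewrite <⇒≡ᵇ-false k (suc m) k<1+m = approx≡root m k (ℕP.≤-pred k<1+m)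

root-suc : ∀ n → root (suc n) ≡ nextCoeff root n
root-suc n rewrite ≡ᵇ-refl n =
  cong₂ (λ a b → 1ℚ ℚ.+ a ℚ.- b) (⊛-local n (approx≡root n) (approx≡root n))
                                  (⊛-local n {Z} (λ _ _ → refl) (approx≡root n))

root-fixpoint : root ≐ Z ⊛ geometric ⊕ Z ⊛ (root ⊛ root) ⊕ -ₛ (Z ⊛ (Z ⊛ root))
root-fixpoint = ≐-trans coefficients (≐-sym
  (⊕-cong (⊕-cong (Z⊛≐shiftʳ geometric) (Z⊛≐shiftʳ (root ⊛ root)))
          (-ₛ-cong (Z⊛≐shiftʳ (Z ⊛ root)))))
  where
  coefficients : root ≐ shiftʳ geometric ⊕ shiftʳ (root ⊛ root) ⊕ -ₛ shiftʳ (Z ⊛ root)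
  coefficients zero = refl
  coefficients (suc n) = root-suc n

root-isRoot : IsRoot root
root-isRoot = ≐-trans (≐-modulo₂ {C₁ = -ₛ Z} {X₁ = 1-z ⊛ geometric ⊕ -ₛ 𝟙} {C₂ = -ₛ 1-z}
                        {X₂ = root ⊕ -ₛ (Z ⊛ geometric ⊕ Z ⊛ (root ⊛ root) ⊕ -ₛ (Z ⊛ (Z ⊛ root)))}
  (solve 3 (λ z g r → let o = con 1ℚ :- z in
     z :* o :* r :* r :- o :* (con 1ℚ :+ z :* z) :* r :+ z :=
     con 0ℚ :+ (:- z) :* (o :* g :- con 1ℚ)
            :+ (:- o) :* (r :- (z :* g :+ z :* (r :* r) :- z :* (z :* r))))
    (λ _ → refl) Z geometric root)
  (difference-zero 1-z⊛geometric) (difference-zero root-fixpoint)) 𝟘≐0ₛ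

rootW : Series
rootW = poly numerator-coeffs ⊖ poly 2z-coeffs ⊛ oneMinusZ ⊛ root

rootW-isR1 : IsR1 rootW root
rootW-isR1 n = ℚ-solve 2 (λ t p → t q= p q+ q- (p q+ q- t)) refl
  ((poly 2z-coeffs ⊛ oneMinusZ ⊛ root) n) (poly numerator-coeffs n)

rootW-isW : IsW rootW
rootW-isW = refl , ≐-trans (⊛-cong rootW≐ rootW≐)
  (≐-trans (≐-modulo₁ {C = constₛ 4ℚ ⊛ Z ⊛ 1-z} {X = quadratic root} (candidateW-square root) root-isRoot)
           (≐-sym radicand≐horner))
  where
  rootW≐ : rootW ≐ candidateW root
  rootW≐ = W≐candidateW rootW root rootW-isR1

W-and-r₁-exist : ∃ λ W → IsW W × ∃ λ r₁ → IsR1 W r₁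
W-and-r₁-exist = rootW , rootW-isW , root , rootW-isR1

-- Counting words by their last letter

indicator : Bool → ℕ
indicator true = 1
indicator false = 0

count : (List Step → Bool) → List (List Step) → ℕ
count p [] = 0
count p (w ∷ ws) = indicator (p w) + count p ws

length-filterᵇ : ∀ p ws → length (filterᵇ p ws) ≡ count p ws
length-filterᵇ p [] = refl
length-filterᵇ p (w ∷ ws) with p w
... | true = cong suc (length-filterᵇ p ws)
... | false = length-filterᵇ p ws

count-cong : ∀ {p p′} ws → (∀ w → p w ≡ p′ w) → count p ws ≡ count p′ ws
count-cong [] e = refl
count-cong (w ∷ ws) e = cong₂ _+_ (cong indicator (e w)) (count-cong ws e)

count-false : ∀ {p} ws → (∀ w → p w ≡ false) → count p ws ≡ 0
count-false [] e = refl
count-false (w ∷ ws) e rewrite e w = count-false ws e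

count-∧ : ∀ p b ws → count (λ w → p w ∧ b) ws ≡ (if b then count p ws else 0)
count-∧ p true ws = count-cong ws (λ w → BP.∧-identityʳ (p w))
count-∧ p false ws = count-false ws (λ w → BP.∧-zeroʳ (p w))

Σ-letters : (Step → ℕ) → ℕ
Σ-letters f = f U + f H + f D

Σ-letters-cong : ∀ {f g} → (∀ x → f x ≡ g x) → Σ-letters f ≡ Σ-letters g
Σ-letters-cong e = cong₂ _+_ (cong₂ _+_ (e U) (e H)) (e D)

Σ-letters-comm : ∀ (c : Step → Step → ℕ) →
                 Σ-letters (λ x → Σ-letters (c x)) ≡ Σ-letters (λ y → Σ-letters (λ x → c x y))
Σ-letters-comm c = ℕ-solve 9 (λ a b c d e f g h i →
  (a n+ b n+ c) n+ (d n+ e n+ f) n+ (g n+ h n+ i) n= (a n+ d n+ g) n+ (b n+ e n+ h) n+ (c n+ f n+ i))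
  refl (c U U) (c U H) (c U D) (c H U) (c H H) (c H D) (c D U) (c D H) (c D D)

count-concatMap : ∀ p ws → count p (concatMap (λ w → (U ∷ w) ∷ (H ∷ w) ∷ (D ∷ w) ∷ []) ws)
                           ≡ Σ-letters (λ x → count (λ w → p (x ∷ w)) ws)
count-concatMap p [] = refl
count-concatMap p (w ∷ ws) =
  trans (cong (λ t → i U + (i H + (i D + t))) (count-concatMap p ws))
        (ℕ-solve 6 (λ a b c d e f → a n+ (b n+ (c n+ (d n+ e n+ f))) n= (a n+ d) n+ (b n+ e) n+ (c n+ f))
          refl (i U) (i H) (i D) (rest U) (rest H) (rest D))
  where
  i : Step → ℕ
  i x = indicator (p (x ∷ w))
  rest : Step → ℕ
  rest x = count (λ v → p (x ∷ v)) ws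

count-allWords-suc : ∀ n p → count p (allWords (suc n))
                             ≡ Σ-letters (λ x → count (λ w → p (w ∷ʳ x)) (allWords n))
count-allWords-suc zero p = count-concatMap p (allWords 0)
count-allWords-suc (suc n) p = begin
  count p (allWords (suc (suc n)))
    ≡⟨ count-concatMap p (allWords (suc n)) ⟩
  Σ-letters (λ x → count (λ w → p (x ∷ w)) (allWords (suc n)))
    ≡⟨ Σ-letters-cong (λ x → count-allWords-suc n (λ w → p (x ∷ w))) ⟩
  Σ-letters (λ x → Σ-letters (λ y → count (λ w → p (x ∷ (w ∷ʳ y))) (allWords n)))
    ≡⟨ Σ-letters-comm (λ x y → count (λ w → p (x ∷ (w ∷ʳ y))) (allWords n)) ⟩
  Σ-letters (λ y → Σ-letters (λ x → count (λ w → p (x ∷ (w ∷ʳ y))) (allWords n)))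
    ≡⟨ Σ-letters-cong (λ y → sym (count-concatMap (λ w → p (w ∷ʳ y)) (allWords n))) ⟩
  Σ-letters (λ y → count (λ w → p (w ∷ʳ y)) (allWords (suc n))) ∎
  where open ≡-Reasoning

lastOf : List Step → Maybe Step
lastOf [] = nothing
lastOf (x ∷ []) = just x
lastOf (x ∷ y ∷ w) = lastOf (y ∷ w)

lastOf-∷ʳ : ∀ w x → lastOf (w ∷ʳ x) ≡ just x
lastOf-∷ʳ [] x = refl
lastOf-∷ʳ (a ∷ []) x = refl
lastOf-∷ʳ (a ∷ b ∷ w) x = lastOf-∷ʳ (b ∷ w) x

afterStep : Maybe ℕ → Step → Maybe ℕ
afterStep nothing x = nothing
afterStep (just h) U = just (suc h)
afterStep (just h) H = just h
afterStep (just zero) D = nothing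
afterStep (just (suc h)) D = just h

heightFrom-∷ʳ : ∀ h w x → heightFrom h (w ∷ʳ x) ≡ afterStep (heightFrom h w) x
heightFrom-∷ʳ h [] U = refl
heightFrom-∷ʳ h [] H = refl
heightFrom-∷ʳ zero [] D = refl
heightFrom-∷ʳ (suc h) [] D = refl
heightFrom-∷ʳ h (U ∷ w) x = heightFrom-∷ʳ (suc h) w x
heightFrom-∷ʳ h (H ∷ w) x = heightFrom-∷ʳ h w x
heightFrom-∷ʳ zero (D ∷ w) x = refl
heightFrom-∷ʳ (suc h) (D ∷ w) x = heightFrom-∷ʳ h w x

levelIs : ℕ → Maybe ℕ → Bool
levelIs j nothing = false
levelIs j (just l) = l ℕ.≡ᵇ j

levelIs-U-zero : ∀ h → levelIs 0 (afterStep h U) ≡ false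
levelIs-U-zero nothing = refl
levelIs-U-zero (just l) = refl

levelIs-U : ∀ j h → levelIs (suc j) (afterStep h U) ≡ levelIs j h
levelIs-U j nothing = refl
levelIs-U j (just l) = refl

levelIs-H : ∀ j h → levelIs j (afterStep h H) ≡ levelIs j h
levelIs-H j nothing = refl
levelIs-H j (just l) = refl

levelIs-D : ∀ j h → levelIs j (afterStep h D) ≡ levelIs (suc j) h
levelIs-D j nothing = refl
levelIs-D j (just zero) = refl
levelIs-D j (just (suc l)) = refl

isMeanderOfLevel≡levelIs : ∀ j w → isMeanderOfLevel j w ≡ levelIs j (heightFrom 0 w)
isMeanderOfLevel≡levelIs j w with heightFrom 0 w
... | nothing = refl
... | just l = refl

lastIs : Step → Maybe Step → Bool
lastIs X nothing = false
lastIs X (just a) = stepEq a X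

canFollow : Step → Maybe Step → Bool
canFollow x m = not (lastIs D m ∧ stepEq x U) ∧ not (lastIs U m ∧ stepEq x H)

canFollow-D : ∀ m → canFollow D m ≡ true
canFollow-D nothing = refl
canFollow-D (just U) = refl
canFollow-D (just H) = refl
canFollow-D (just D) = refl

avoids : List Step → Bool
avoids w = not (containsPair D U w) ∧ not (containsPair U H w)

not-∨-∧ : ∀ p q c d → not (p ∨ c) ∧ not (q ∨ d) ≡ (not p ∧ not q) ∧ (not c ∧ not d)
not-∨-∧ true q c d = refl
not-∨-∧ false true c d = BP.∧-zeroʳ (not c)
not-∨-∧ false false c d = refl

avoids-∷ʳ : ∀ w x → avoids (w ∷ʳ x) ≡ avoids w ∧ canFollow x (lastOf w)
avoids-∷ʳ [] x = refl
avoids-∷ʳ (a ∷ []) x =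
  cong₂ (λ p q → not p ∧ not q) (BP.∨-identityʳ (stepEq a D ∧ stepEq x U))
                                (BP.∨-identityʳ (stepEq a U ∧ stepEq x H))
avoids-∷ʳ (a ∷ b ∷ w) x = begin
  avoids (a ∷ b ∷ w ∷ʳ x)
    ≡⟨ not-∨-∧ p q (containsPair D U (b ∷ w ∷ʳ x)) (containsPair U H (b ∷ w ∷ʳ x)) ⟩
  (not p ∧ not q) ∧ avoids (b ∷ w ∷ʳ x)
    ≡⟨ cong ((not p ∧ not q) ∧_) (avoids-∷ʳ (b ∷ w) x) ⟩
  (not p ∧ not q) ∧ (avoids (b ∷ w) ∧ canFollow x (lastOf (b ∷ w)))
    ≡⟨ sym (BP.∧-assoc (not p ∧ not q) (avoids (b ∷ w)) _) ⟩
  ((not p ∧ not q) ∧ avoids (b ∷ w)) ∧ canFollow x (lastOf (b ∷ w))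
    ≡⟨ cong (_∧ canFollow x (lastOf (b ∷ w)))
            (sym (not-∨-∧ p q (containsPair D U (b ∷ w)) (containsPair U H (b ∷ w)))) ⟩
  avoids (a ∷ b ∷ w) ∧ canFollow x (lastOf (a ∷ b ∷ w)) ∎
  where
  open ≡-Reasoning
  p = stepEq a D ∧ stepEq b U
  q = stepEq a U ∧ stepEq b H

inMOfLevel≡ : ∀ j w → inMOfLevel j w ≡ levelIs j (heightFrom 0 w) ∧ avoids w
inMOfLevel≡ j w = cong (_∧ avoids w) (isMeanderOfLevel≡levelIs j w)

inMOfLevel-∷ʳ : ∀ {i j} w x → levelIs i (afterStep (heightFrom 0 w) x) ≡ levelIs j (heightFrom 0 w) →
                inMOfLevel i (w ∷ʳ x) ≡ inMOfLevel j w ∧ canFollow x (lastOf w)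
inMOfLevel-∷ʳ {i} {j} w x level = begin
  inMOfLevel i (w ∷ʳ x)
    ≡⟨ inMOfLevel≡ i (w ∷ʳ x) ⟩
  levelIs i (heightFrom 0 (w ∷ʳ x)) ∧ avoids (w ∷ʳ x)
    ≡⟨ cong₂ _∧_ (trans (cong (levelIs i) (heightFrom-∷ʳ 0 w x)) level) (avoids-∷ʳ w x) ⟩
  levelIs j (heightFrom 0 w) ∧ (avoids w ∧ canFollow x (lastOf w))
    ≡⟨ sym (BP.∧-assoc (levelIs j (heightFrom 0 w)) (avoids w) _) ⟩
  (levelIs j (heightFrom 0 w) ∧ avoids w) ∧ canFollow x (lastOf w)
    ≡⟨ cong (_∧ canFollow x (lastOf w)) (sym (inMOfLevel≡ j w)) ⟩
  inMOfLevel j w ∧ canFollow x (lastOf w) ∎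
  where open ≡-Reasoning

inMOfLevel-zero-∷ʳU : ∀ w → inMOfLevel 0 (w ∷ʳ U) ≡ false
inMOfLevel-zero-∷ʳU w = trans (inMOfLevel≡ 0 (w ∷ʳ U))
  (cong (_∧ avoids (w ∷ʳ U)) (trans (cong (levelIs 0) (heightFrom-∷ʳ 0 w U)) (levelIs-U-zero (heightFrom 0 w))))

infix 4 _≡ᵐ_
_≡ᵐ_ : Maybe Step → Maybe Step → Bool
nothing ≡ᵐ nothing = true
just a ≡ᵐ just b = stepEq a b
_ ≡ᵐ _ = false

≡ᵐ-sound : ∀ l m → (l ≡ᵐ m) ≡ true → l ≡ m
≡ᵐ-sound nothing nothing _ = refl
≡ᵐ-sound (just U) (just U) _ = refl
≡ᵐ-sound (just H) (just H) _ = refl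
≡ᵐ-sound (just D) (just D) _ = refl

∧-≡ᵐ-subst : ∀ b (f : Maybe Step → Bool) l m → (b ∧ f m) ∧ (l ≡ᵐ m) ≡ (b ∧ (l ≡ᵐ m)) ∧ f l
∧-≡ᵐ-subst b f l m with l ≡ᵐ m in eq
... | false = trans (BP.∧-zeroʳ (b ∧ f m)) (cong (_∧ f l) (sym (BP.∧-zeroʳ b)))
... | true rewrite ≡ᵐ-sound l m eq =
  trans (BP.∧-identityʳ (b ∧ f m)) (cong (_∧ f m) (sym (BP.∧-identityʳ b)))

Σ-last : (Maybe Step → ℕ) → ℕ
Σ-last f = f nothing + f (just U) + f (just H) + f (just D)

Σ-last-cong : ∀ {f g} → (∀ l → f l ≡ g l) → Σ-last f ≡ Σ-last g
Σ-last-cong e = cong₂ _+_ (cong₂ _+_ (cong₂ _+_ (e nothing) (e (just U))) (e (just H))) (e (just D))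

indicator-byLast : ∀ b m → indicator b ≡ Σ-last (λ l → indicator (b ∧ (l ≡ᵐ m)))
indicator-byLast false m = refl
indicator-byLast true nothing = refl
indicator-byLast true (just U) = refl
indicator-byLast true (just H) = refl
indicator-byLast true (just D) = refl

count-byLast : ∀ p ws → count p ws ≡ Σ-last (λ l → count (λ w → p w ∧ (l ≡ᵐ lastOf w)) ws)
count-byLast p [] = refl
count-byLast p (w ∷ ws) =
  trans (cong₂ _+_ (indicator-byLast (p w) (lastOf w)) (count-byLast p ws))
        (ℕ-solve 8 (λ a b c d e f g h →
           (a n+ b n+ c n+ d) n+ (e n+ f n+ g n+ h) n= (a n+ e) n+ (b n+ f) n+ (c n+ g) n+ (d n+ h))
           refl (i nothing) (i (just U)) (i (just H)) (i (just D))
                (rest nothing) (rest (just U)) (rest (just H)) (rest (just D)))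
  where
  i : Maybe Step → ℕ
  i l = indicator (p w ∧ (l ≡ᵐ lastOf w))
  rest : Maybe Step → ℕ
  rest l = count (λ v → p v ∧ (l ≡ᵐ lastOf v)) ws

-- l = nothing stands for the empty word.
countByLast : ℕ → ℕ → Maybe Step → ℕ
countByLast n j l = count (λ w → inMOfLevel j w ∧ (l ≡ᵐ lastOf w)) (allWords n)

countM≡Σ-last : ∀ n j → countM n j ≡ Σ-last (countByLast n j)
countM≡Σ-last n j = trans (length-filterᵇ (inMOfLevel j) (allWords n)) (count-byLast (inMOfLevel j) (allWords n))

count-canFollow : ∀ n j x → count (λ w → inMOfLevel j w ∧ canFollow x (lastOf w)) (allWords n)
                            ≡ Σ-last (λ l → if canFollow x l then countByLast n j l else 0)
count-canFollow n j x = trans (count-byLast _ (allWords n)) (Σ-last-cong λ l →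
  trans (count-cong (allWords n) (λ w → ∧-≡ᵐ-subst (inMOfLevel j w) (canFollow x) l (lastOf w)))
        (count-∧ (λ w → inMOfLevel j w ∧ (l ≡ᵐ lastOf w)) (canFollow x l) (allWords n)))

countByLast-suc : ∀ n j l → countByLast (suc n) j l
  ≡ Σ-letters (λ x → if l ≡ᵐ just x then count (λ w → inMOfLevel j (w ∷ʳ x)) (allWords n) else 0)
countByLast-suc n j l = trans (count-allWords-suc n _) (Σ-letters-cong λ x →
  trans (count-cong (allWords n) (λ w → cong (λ m → inMOfLevel j (w ∷ʳ x) ∧ (l ≡ᵐ m)) (lastOf-∷ʳ w x)))
        (count-∧ (λ w → inMOfLevel j (w ∷ʳ x)) (l ≡ᵐ just x) (allWords n)))

countByLast-suc-U-zero : ∀ n → countByLast (suc n) 0 (just U) ≡ 0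
countByLast-suc-U-zero n =
  trans (countByLast-suc n 0 (just U)) (cong (λ c → c + 0 + 0) (count-false (allWords n) inMOfLevel-zero-∷ʳU))

countByLast-suc-U : ∀ n j → countByLast (suc n) (suc j) (just U)
                            ≡ countByLast n j nothing + countByLast n j (just U) + countByLast n j (just H)
countByLast-suc-U n j = begin
  countByLast (suc n) (suc j) (just U)
    ≡⟨ countByLast-suc n (suc j) (just U) ⟩
  count (λ w → inMOfLevel (suc j) (w ∷ʳ U)) (allWords n) + 0 + 0
    ≡⟨ trans (ℕP.+-identityʳ _) (ℕP.+-identityʳ _) ⟩
  count (λ w → inMOfLevel (suc j) (w ∷ʳ U)) (allWords n)
    ≡⟨ count-cong (allWords n) (λ w → inMOfLevel-∷ʳ w U (levelIs-U j (heightFrom 0 w))) ⟩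
  count (λ w → inMOfLevel j w ∧ canFollow U (lastOf w)) (allWords n)
    ≡⟨ count-canFollow n j U ⟩
  countByLast n j nothing + countByLast n j (just U) + countByLast n j (just H) + 0
    ≡⟨ ℕP.+-identityʳ _ ⟩
  countByLast n j nothing + countByLast n j (just U) + countByLast n j (just H) ∎
  where open ≡-Reasoning

countByLast-suc-H : ∀ n j → countByLast (suc n) j (just H)
                            ≡ countByLast n j nothing + countByLast n j (just H) + countByLast n j (just D)
countByLast-suc-H n j = begin
  countByLast (suc n) j (just H)
    ≡⟨ countByLast-suc n j (just H) ⟩
  0 + count (λ w → inMOfLevel j (w ∷ʳ H)) (allWords n) + 0
    ≡⟨ ℕP.+-identityʳ _ ⟩
  count (λ w → inMOfLevel j (w ∷ʳ H)) (allWords n)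
    ≡⟨ count-cong (allWords n) (λ w → inMOfLevel-∷ʳ w H (levelIs-H j (heightFrom 0 w))) ⟩
  count (λ w → inMOfLevel j w ∧ canFollow H (lastOf w)) (allWords n)
    ≡⟨ count-canFollow n j H ⟩
  countByLast n j nothing + 0 + countByLast n j (just H) + countByLast n j (just D)
    ≡⟨ cong (λ t → t + countByLast n j (just H) + countByLast n j (just D)) (ℕP.+-identityʳ _) ⟩
  countByLast n j nothing + countByLast n j (just H) + countByLast n j (just D) ∎
  where open ≡-Reasoning

countByLast-suc-D : ∀ n j → countByLast (suc n) j (just D) ≡ Σ-last (countByLast n (suc j))
countByLast-suc-D n j = begin
  countByLast (suc n) j (just D)
    ≡⟨ countByLast-suc n j (just D) ⟩
  count (λ w → inMOfLevel j (w ∷ʳ D)) (allWords n)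
    ≡⟨ count-cong (allWords n) (λ w →
         trans (inMOfLevel-∷ʳ w D (levelIs-D j (heightFrom 0 w)))
               (trans (cong (inMOfLevel (suc j) w ∧_) (canFollow-D (lastOf w))) (BP.∧-identityʳ _))) ⟩
  count (inMOfLevel (suc j)) (allWords n)
    ≡⟨ count-byLast (inMOfLevel (suc j)) (allWords n) ⟩
  Σ-last (countByLast n (suc j)) ∎
  where open ≡-Reasoning

ℕ→ℚ-suc : ∀ n → ℕ→ℚ (suc n) ≡ 1ℚ ℚ.+ ℕ→ℚ n
ℕ→ℚ-suc n = sym (trans (cong₂ ℚ._+_ (as-mkℚ 1) (as-mkℚ n)) (cong (ℚ._/ 1) numerators))
  where
  as-mkℚ : ∀ m → ℕ→ℚ m ≡ ℚ.mkℚ (ℤ.+ m) 0 (Cop.sym (Cop.1-coprimeTo m))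
  as-mkℚ m = ℚP.normalize-coprime (Cop.sym (Cop.1-coprimeTo m))
  numerators : ℤ.+ 1 ℤ.+ (Sign.+ ℤ.◃ n ℕ.* 1) ≡ ℤ.+ suc n
  numerators = cong (λ k → ℤ.+ 1 ℤ.+ k) (trans (ℤP.+◃n≡+n (n ℕ.* 1)) (cong ℤ.+_ (ℕP.*-identityʳ n)))

ℕ→ℚ-+ : ∀ a b → ℕ→ℚ (a + b) ≡ ℕ→ℚ a ℚ.+ ℕ→ℚ b
ℕ→ℚ-+ zero b = sym (ℚP.+-identityˡ (ℕ→ℚ b))
ℕ→ℚ-+ (suc a) b = trans (ℕ→ℚ-suc (a + b)) (trans (cong (1ℚ ℚ.+_) (ℕ→ℚ-+ a b))
  (trans (sym (ℚP.+-assoc 1ℚ (ℕ→ℚ a) (ℕ→ℚ b))) (cong (ℚ._+ ℕ→ℚ b) (sym (ℕ→ℚ-suc a)))))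

Σ-lastₛ : (Maybe Step → Series) → Series
Σ-lastₛ f = f nothing ⊕ f (just U) ⊕ f (just H) ⊕ f (just D)

ℕ→ℚ-+₃ : ∀ a b c → ℕ→ℚ (a + b + c) ≡ ℕ→ℚ a ℚ.+ ℕ→ℚ b ℚ.+ ℕ→ℚ c
ℕ→ℚ-+₃ a b c = trans (ℕ→ℚ-+ (a + b) c) (cong (ℚ._+ ℕ→ℚ c) (ℕ→ℚ-+ a b))

Σ-last-transfer : ∀ {f g} n → (∀ l → ℕ→ℚ (f l) ≡ g l n) → ℕ→ℚ (Σ-last f) ≡ Σ-lastₛ g n
Σ-last-transfer {f} n e = trans (ℕ→ℚ-+ (f nothing + f (just U) + f (just H)) (f (just D)))
  (cong₂ ℚ._+_ (trans (ℕ→ℚ-+₃ (f nothing) (f (just U)) (f (just H)))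
                      (cong₂ ℚ._+_ (cong₂ ℚ._+_ (e nothing) (e (just U))) (e (just H))))
               (e (just D)))

lift-⊛₂ : ∀ f F n j → (lift f ⊛₂ F) n j ≡ (f ⊛ coeffU j F) n
lift-⊛₂ f F n j = Σ≤-cong′ n (λ a → Σ≤-head j _ (λ b → ℚP.*-zeroˡ (F (n ∸ a) (j ∸ suc b))))

Uvar-⊛₂-zero : ∀ F n → (Uvar ⊛₂ F) n 0 ≡ 0ℚ
Uvar-⊛₂-zero F n = Σ≤-zero n _ λ
  { zero → ℚP.*-zeroˡ (F n 0)
  ; (suc a) → ℚP.*-zeroˡ (F (n ∸ suc a) 0) }

Uvar-⊛₂-suc : ∀ F n j → (Uvar ⊛₂ F) n (suc j) ≡ F n j
Uvar-⊛₂-suc F n j = begin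
  (Uvar ⊛₂ F) n (suc j)
    ≡⟨ Σ≤-head n _ (λ a → Σ≤-zero (suc j) _ (λ b → ℚP.*-zeroˡ (F (n ∸ suc a) (suc j ∸ b)))) ⟩
  Σ≤ (suc j) (λ b → Uvar 0 b ℚ.* F n (suc j ∸ b))
    ≡⟨ Σ≤-suc j _ ⟩
  0ℚ ℚ.* F n (suc j) ℚ.+ Σ≤ j (λ b → Uvar 0 (suc b) ℚ.* F n (j ∸ b))
    ≡⟨ cong₂ ℚ._+_ (ℚP.*-zeroˡ (F n (suc j))) (Σ≤-head j _ (λ b → ℚP.*-zeroˡ (F n (j ∸ suc b)))) ⟩
  0ℚ ℚ.+ 1ℚ ℚ.* F n j
    ≡⟨ trans (ℚP.+-identityˡ _) (ℚP.*-identityˡ (F n j)) ⟩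
  F n j ∎
  where open ≡-Reasoning

⊛₂-suc-linear : ∀ F G → (∀ b → coeffU (suc (suc b)) F ≐ 0ₛ) → ∀ n k →
                (F ⊛₂ G) n (suc k) ≡ (coeffU 0 F ⊛ coeffU (suc k) G) n ℚ.+ (coeffU 1 F ⊛ coeffU k G) n
⊛₂-suc-linear F G linear n k = trans
  (Σ≤-cong′ n (λ a → trans (Σ≤-suc k _) (cong (F a 0 ℚ.* G (n ∸ a) (suc k) ℚ.+_)
    (Σ≤-head k _ (λ b → trans (cong (ℚ._* G (n ∸ a) (k ∸ suc b)) (linear b a))
                              (ℚP.*-zeroˡ (G (n ∸ a) (k ∸ suc b))))))))
  (Σ≤-distrib-+ n (λ a → F a 0 ℚ.* G (n ∸ a) (suc k)) (λ a → F a 1 ℚ.* G (n ∸ a) k))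

-- Series attached to a root of the quadratic

module RootSeries (r : Series) (r-root : IsRoot r) where

  q : Series
  q = 1-z ⊛ r

  -- E = (r - z)/z², see r≐z+z²E
  E : Series
  E n = r (suc (suc n))

  cofactor : Series
  cofactor = 1-z ⊛ r ⊕ 𝟙 ⊕ -ₛ Z ⊕ Z ⊛ Z

  r≐Z⊛ : r ≐ Z ⊛ (𝟙 ⊕ r ⊛ cofactor)
  r≐Z⊛ = ≐-modulo₁ {C = -ₛ 𝟙} {X = quadratic r}
    (solve 2 (λ z r → let o = con 1ℚ :- z in
      r := z :* (con 1ℚ :+ r :* (o :* r :+ con 1ℚ :- z :+ z :* z))
           :+ (:- con 1ℚ) :* (z :* o :* r :* r :- o :* (con 1ℚ :+ z :* z) :* r :+ z))
      (λ _ → refl) Z r)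
    r-root

  r-zero : r 0 ≡ 0ℚ
  r-zero = trans (r≐Z⊛ 0) (Z⊛-zero (𝟙 ⊕ r ⊛ cofactor))

  r-one : r 1 ≡ 1ℚ
  r-one = trans (r≐Z⊛ 1) (trans (Z⊛-suc (𝟙 ⊕ r ⊛ cofactor) 0) (cong (1ℚ ℚ.+_)
    (trans (cong (ℚ._* cofactor 0) r-zero) (ℚP.*-zeroˡ (cofactor 0)))))

  r≐z+z²E : r ≐ Z ⊕ Z ⊛ (Z ⊛ E)
  r≐z+z²E zero = trans r-zero (sym (cong (0ℚ ℚ.+_) (Z⊛-zero (Z ⊛ E))))
  r≐z+z²E (suc zero) = trans r-one (sym (cong (1ℚ ℚ.+_) (trans (Z⊛-suc (Z ⊛ E) 0) (Z⊛-zero E))))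
  r≐z+z²E (suc (suc n)) =
    sym (trans (cong (0ℚ ℚ.+_) (trans (Z⊛-suc (Z ⊛ E) (suc n)) (Z⊛-suc E n))) (ℚP.+-identityˡ (E n)))

  E-equation : 1-z ⊛ E ≐ 𝟙 ⊕ Z ⊛ E ⊛ q
  E-equation = difference-zero⁻¹ (Z⊛-cancel (Z⊛-cancel (≐-trans
    (≐-modulo₂ {C₁ = -ₛ 𝟙} {X₁ = quadratic r}
               {C₂ = -ₛ (1-z ⊕ -ₛ (Z ⊛ q))} {X₂ = r ⊕ -ₛ (Z ⊕ Z ⊛ (Z ⊛ E))}
      (solve 3 (λ z r e → let o = con 1ℚ :- z ; q = o :* r in
        z :* (z :* (o :* e :- (con 1ℚ :+ z :* e :* q))) :=
        con 0ℚ :+ (:- con 1ℚ) :* (z :* o :* r :* r :- o :* (con 1ℚ :+ z :* z) :* r :+ z)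
               :+ (:- (o :- z :* q)) :* (r :- (z :+ z :* (z :* e))))
        (λ _ → refl) Z r E)
      r-root (difference-zero r≐z+z²E))
    𝟘≐0ₛ)))

  q-equation : q ≐ Z ⊕ -ₛ (Z ⊛ Z ⊛ q) ⊕ Z ⊛ Z ⊛ geometric ⊛ q ⊛ q ⊕ Z ⊛ q ⊛ q
  q-equation = ≐-modulo₂ {C₁ = -ₛ (geometric ⊛ 1-z)} {X₁ = quadratic r}
    {C₂ = -ₛ (geometric ⊛ Z ⊛ Z ⊛ q ⊛ q ⊕ (q ⊕ -ₛ qRHS))} {X₂ = 1-z ⊛ geometric ⊕ -ₛ 𝟙}
    (solve 3 (λ z r g → let o = con 1ℚ :- z ; q = o :* r
                            t = z :- z :* z :* q :+ z :* z :* g :* q :* q :+ z :* q :* q in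
       q := t :+ (:- (g :* o)) :* (z :* o :* r :* r :- o :* (con 1ℚ :+ z :* z) :* r :+ z)
              :+ (:- (g :* z :* z :* q :* q :+ (q :- t))) :* (o :* g :- con 1ℚ))
       (λ _ → refl) Z r geometric)
    r-root (difference-zero 1-z⊛geometric)
    where
    qRHS : Series
    qRHS = Z ⊕ -ₛ (Z ⊛ Z ⊛ q) ⊕ Z ⊛ Z ⊛ geometric ⊛ q ⊛ q ⊕ Z ⊛ q ⊛ q

  levelSeries : ℕ → Series
  levelSeries j = E ⊛ q ^ₛ j

  -- What byLast l j should be, following countByLast-suc-U/H/D; endingH is the solution of its
  -- own recurrence (endingH-equation), and endingD presumes the level-(j + 1) total E q^(j + 1).
  emptyWord : ℕ → Series
  emptyWord zero = 𝟙
  emptyWord (suc j) = 𝟘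

  endingD endingH endingU : ℕ → Series
  endingD j = Z ⊛ levelSeries (suc j)
  endingH j = Z ⊛ (geometric ⊛ (emptyWord j ⊕ endingD j))
  endingU zero = 𝟘
  endingU (suc j) = Z ⊛ (emptyWord j ⊕ endingU j ⊕ endingH j)

  byLast : Maybe Step → ℕ → Series
  byLast nothing = emptyWord
  byLast (just U) = endingU
  byLast (just H) = endingH
  byLast (just D) = endingD

  endingH-equation : ∀ j → endingH j ≐ Z ⊛ (emptyWord j ⊕ endingH j ⊕ endingD j)
  endingH-equation j = ≐-modulo₁ {C = Z ⊛ (δ ⊕ d)} {X = 1-z ⊛ geometric ⊕ -ₛ 𝟙}
    (solve 4 (λ z g δ d → z :* (g :* (δ :+ d)) :=
       z :* (δ :+ z :* (g :* (δ :+ d)) :+ d) :+ z :* (δ :+ d) :* ((con 1ℚ :- z) :* g :- con 1ℚ))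
      (λ _ → refl) Z geometric δ d)
    (difference-zero 1-z⊛geometric)
    where
    δ = emptyWord j
    d = endingD j

  levelSeries≐Σ-last : ∀ j → levelSeries j ≐ Σ-lastₛ (λ l → byLast l j)
  levelSeries≐Σ-last zero = ≐-modulo₃
      {C₁ = 𝟙 ⊕ Z ⊛ E ⊛ q ⊕ -ₛ E} {X₁ = 1-z ⊛ geometric ⊕ -ₛ 𝟙}
      {C₂ = geometric} {X₂ = 1-z ⊛ E ⊕ -ₛ (𝟙 ⊕ Z ⊛ E ⊛ q)}
      {C₃ = E ⊕ -ₛ (Z ⊛ Z ⊛ geometric ⊛ E ⊛ q) ⊕ -ₛ (Z ⊛ E ⊛ q)} {X₃ = one ⊕ -ₛ 𝟙}
    (solve 5 (λ z r g e w → let o = con 1ℚ :- z ; q = o :* r in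
       e :* w := con 1ℚ :+ con 0ℚ :+ z :* (g :* (con 1ℚ :+ z :* (e :* (q :* w)))) :+ z :* (e :* (q :* w))
                 :+ (con 1ℚ :+ z :* e :* q :- e) :* (o :* g :- con 1ℚ)
                 :+ g :* (o :* e :- (con 1ℚ :+ z :* e :* q))
                 :+ (e :- z :* z :* g :* e :* q :- z :* e :* q) :* (w :- con 1ℚ))
      (λ _ → refl) Z r geometric E one)
    (difference-zero 1-z⊛geometric) (difference-zero E-equation) (difference-zero one≐𝟙)
  levelSeries≐Σ-last (suc k) = ≐-trans
    (≐-modulo₁ {R = 𝟘 ⊕ Z ⊛ (levelSeries k ⊕ -ₛ endingD k) ⊕ endingH (suc k) ⊕ endingD (suc k)}
               {C = E ⊛ q ^ₛ k}
               {X = q ⊕ -ₛ (Z ⊕ -ₛ (Z ⊛ Z ⊛ q) ⊕ Z ⊛ Z ⊛ geometric ⊛ q ⊛ q ⊕ Z ⊛ q ⊛ q)}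
      (solve 5 (λ z r g e x → let o = con 1ℚ :- z ; q = o :* r
                                  t = z :- z :* z :* q :+ z :* z :* g :* q :* q :+ z :* q :* q
                                  d = z :* (e :* (q :* (q :* x))) in
        e :* (q :* x) := con 0ℚ :+ z :* (e :* x :- z :* (e :* (q :* x))) :+ z :* (g :* (con 0ℚ :+ d)) :+ d
                         :+ e :* x :* (q :- t))
        (λ _ → refl) Z r geometric E (q ^ₛ k))
      (difference-zero q-equation))
    (λ n → cong (λ u → 𝟘 n ℚ.+ u ℚ.+ endingH (suc k) n ℚ.+ endingD (suc k) n)
                (⊛-congˡ Z (≐-sym lower-letters) n))
    where
    lower-letters : emptyWord k ⊕ endingU k ⊕ endingH k ≐ levelSeries k ⊕ -ₛ endingD k
    lower-letters n = trans
      (ℚ-solve 2 (λ a d → a q= (a q+ d) q+ q- d) refl ((emptyWord k ⊕ endingU k ⊕ endingH k) n) (endingD k n))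
      (cong (ℚ._+ ℚ.- endingD k n) (sym (levelSeries≐Σ-last k n)))

  countByLast-zero-just : ∀ j x → countByLast 0 j (just x) ≡ 0
  countByLast-zero-just j x = cong (λ b → indicator b + 0) (BP.∧-zeroʳ (inMOfLevel j []))

  countByLast≡byLast : ∀ n j l → ℕ→ℚ (countByLast n j l) ≡ byLast l j n
  countByLast≡byLast zero zero nothing = refl
  countByLast≡byLast zero (suc j) nothing = refl
  countByLast≡byLast zero zero (just U) = cong ℕ→ℚ (countByLast-zero-just 0 U)
  countByLast≡byLast zero (suc j) (just U) =
    trans (cong ℕ→ℚ (countByLast-zero-just (suc j) U)) (sym (Z⊛-zero (emptyWord j ⊕ endingU j ⊕ endingH j)))
  countByLast≡byLast zero j (just H) =
    trans (cong ℕ→ℚ (countByLast-zero-just j H)) (sym (Z⊛-zero (geometric ⊛ (emptyWord j ⊕ endingD j))))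
  countByLast≡byLast zero j (just D) =
    trans (cong ℕ→ℚ (countByLast-zero-just j D)) (sym (Z⊛-zero (levelSeries (suc j))))
  countByLast≡byLast (suc n) zero nothing = cong ℕ→ℚ (countByLast-suc n 0 nothing)
  countByLast≡byLast (suc n) (suc j) nothing = cong ℕ→ℚ (countByLast-suc n (suc j) nothing)
  countByLast≡byLast (suc n) zero (just U) = cong ℕ→ℚ (countByLast-suc-U-zero n)
  countByLast≡byLast (suc n) (suc j) (just U) = begin
    ℕ→ℚ (countByLast (suc n) (suc j) (just U))
      ≡⟨ cong ℕ→ℚ (countByLast-suc-U n j) ⟩
    ℕ→ℚ (countByLast n j nothing + countByLast n j (just U) + countByLast n j (just H))
      ≡⟨ ℕ→ℚ-+₃ (countByLast n j nothing) (countByLast n j (just U)) (countByLast n j (just H)) ⟩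
    ℕ→ℚ (countByLast n j nothing) ℚ.+ ℕ→ℚ (countByLast n j (just U)) ℚ.+ ℕ→ℚ (countByLast n j (just H))
      ≡⟨ cong₂ ℚ._+_ (cong₂ ℚ._+_ (countByLast≡byLast n j nothing) (countByLast≡byLast n j (just U)))
                     (countByLast≡byLast n j (just H)) ⟩
    (emptyWord j ⊕ endingU j ⊕ endingH j) n
      ≡⟨ sym (Z⊛-suc (emptyWord j ⊕ endingU j ⊕ endingH j) n) ⟩
    endingU (suc j) (suc n) ∎
    where open ≡-Reasoning
  countByLast≡byLast (suc n) j (just H) = begin
    ℕ→ℚ (countByLast (suc n) j (just H))
      ≡⟨ cong ℕ→ℚ (countByLast-suc-H n j) ⟩
    ℕ→ℚ (countByLast n j nothing + countByLast n j (just H) + countByLast n j (just D))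
      ≡⟨ ℕ→ℚ-+₃ (countByLast n j nothing) (countByLast n j (just H)) (countByLast n j (just D)) ⟩
    ℕ→ℚ (countByLast n j nothing) ℚ.+ ℕ→ℚ (countByLast n j (just H)) ℚ.+ ℕ→ℚ (countByLast n j (just D))
      ≡⟨ cong₂ ℚ._+_ (cong₂ ℚ._+_ (countByLast≡byLast n j nothing) (countByLast≡byLast n j (just H)))
                     (countByLast≡byLast n j (just D)) ⟩
    (emptyWord j ⊕ endingH j ⊕ endingD j) n
      ≡⟨ sym (Z⊛-suc (emptyWord j ⊕ endingH j ⊕ endingD j) n) ⟩
    (Z ⊛ (emptyWord j ⊕ endingH j ⊕ endingD j)) (suc n)
      ≡⟨ sym (endingH-equation j (suc n)) ⟩
    endingH j (suc n) ∎
    where open ≡-Reasoning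
  countByLast≡byLast (suc n) j (just D) = begin
    ℕ→ℚ (countByLast (suc n) j (just D))
      ≡⟨ cong ℕ→ℚ (countByLast-suc-D n j) ⟩
    ℕ→ℚ (Σ-last (countByLast n (suc j)))
      ≡⟨ Σ-last-transfer {countByLast n (suc j)} {λ l → byLast l (suc j)} n (countByLast≡byLast n (suc j)) ⟩
    Σ-lastₛ (λ l → byLast l (suc j)) n
      ≡⟨ sym (levelSeries≐Σ-last (suc j) n) ⟩
    levelSeries (suc j) n
      ≡⟨ sym (Z⊛-suc (levelSeries (suc j)) n) ⟩
    endingD j (suc n) ∎
    where open ≡-Reasoning

  coeffU-S≐levelSeries : ∀ j → coeffU j S ≐ levelSeries j
  coeffU-S≐levelSeries j n = begin
    ℕ→ℚ (countM n j)
      ≡⟨ cong ℕ→ℚ (countM≡Σ-last n j) ⟩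
    ℕ→ℚ (Σ-last (countByLast n j))
      ≡⟨ Σ-last-transfer {countByLast n j} {λ l → byLast l j} n (countByLast≡byLast n j) ⟩
    Σ-lastₛ (λ l → byLast l j) n
      ≡⟨ sym (levelSeries≐Σ-last j n) ⟩
    levelSeries j n ∎
    where open ≡-Reasoning

  q^j≐ : ∀ j → q ^ₛ j ≐ oneMinusZ ^ₛ j ⊛ r ^ₛ j
  q^j≐ j = ≐-trans (^ₛ-distrib-⊛ 1-z r j)
    (⊛-cong {g = r ^ₛ j} (^ₛ-cong j (≐-sym oneMinusZ≐1-z)) (λ _ → refl))

  -- The formula also holds for j = 0, where it reads z² [u⁰]S = r - z.
  coefficient-formula : ∀ j → Z ^ₛ 2 ⊛ coeffU j S
    ≐ (oneMinusZ ^ₛ j) ⊛ (r ^ₛ (j + 1)) ⊖ Z ⊛ (oneMinusZ ^ₛ j) ⊛ (r ^ₛ j)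
  coefficient-formula j rewrite ℕP.+-comm j 1 =
    ≐-trans (⊛-congˡ (Z ^ₛ 2) (≐-trans (coeffU-S≐levelSeries j) (⊛-congˡ E (q^j≐ j))))
      (≐-modulo₁ {C = -ₛ (a ⊛ b)} {X = r ⊕ -ₛ (Z ⊕ Z ⊛ (Z ⊛ E))}
        (solve 5 (λ z e a b r → z :^ 2 :* (e :* (a :* b)) :=
            a :* (r :* b) :- z :* a :* b :+ (:- (a :* b)) :* (r :- (z :+ z :* (z :* e))))
          (λ _ → refl) Z E a b r)
        (difference-zero r≐z+z²E))
    where
    a = oneMinusZ ^ₛ j
    b = r ^ₛ j

  kernel : Series₂
  kernel = lift one ⊖₂ Uvar ⊛₂ lift (oneMinusZ ⊛ r)

  kernel-coeff₀ : coeffU 0 kernel ≐ one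
  kernel-coeff₀ n = trans (cong (λ x → one n ℚ.- x) (Uvar-⊛₂-zero (lift (oneMinusZ ⊛ r)) n))
                          (ℚP.+-identityʳ (one n))

  kernel-coeff₁ : coeffU 1 kernel ≐ -ₛ q
  kernel-coeff₁ n = trans (cong (λ x → 0ℚ ℚ.- x) (Uvar-⊛₂-suc (lift (oneMinusZ ⊛ r)) n 0))
    (trans (ℚP.+-identityˡ _) (cong ℚ.-_ (⊛-cong {g = r} oneMinusZ≐1-z (λ _ → refl) n)))

  kernel-coeff₂₊ : ∀ b → coeffU (suc (suc b)) kernel ≐ 0ₛ
  kernel-coeff₂₊ b n = cong (λ x → 0ℚ ℚ.- x) (Uvar-⊛₂-suc (lift (oneMinusZ ⊛ r)) n (suc b))

  z²kernel : Series₂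
  z²kernel = lift (Z ^ₛ 2) ⊛₂ kernel

  z²kernel-coeff₀ : coeffU 0 z²kernel ≐ Z ^ₛ 2 ⊛ one
  z²kernel-coeff₀ n = trans (lift-⊛₂ (Z ^ₛ 2) kernel n 0) (⊛-congˡ (Z ^ₛ 2) kernel-coeff₀ n)

  z²kernel-coeff₁ : coeffU 1 z²kernel ≐ Z ^ₛ 2 ⊛ -ₛ q
  z²kernel-coeff₁ n = trans (lift-⊛₂ (Z ^ₛ 2) kernel n 1) (⊛-congˡ (Z ^ₛ 2) kernel-coeff₁ n)

  z²kernel-coeff₂₊ : ∀ b → coeffU (suc (suc b)) z²kernel ≐ 0ₛ
  z²kernel-coeff₂₊ b n = trans (lift-⊛₂ (Z ^ₛ 2) kernel n (suc (suc b)))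
    (≐-trans (⊛-congˡ (Z ^ₛ 2) (kernel-coeff₂₊ b)) (⊛-zeroʳ (Z ^ₛ 2)) n)

  functional-equation : z²kernel ⊛₂ S ≐₂ lift (r ⊖ Z)
  functional-equation n zero =
    ≐-trans (⊛-cong z²kernel-coeff₀ (coeffU-S≐levelSeries 0))
      (≐-modulo₂ {R = r ⊖ Z} {C₁ = -ₛ 𝟙} {X₁ = r ⊕ -ₛ (Z ⊕ Z ⊛ (Z ⊛ E))}
                 {C₂ = Z ^ₛ 2 ⊛ E ⊛ (one ⊕ 𝟙)} {X₂ = one ⊕ -ₛ 𝟙}
        (solve 4 (λ z e r w → z :^ 2 :* w :* (e :* w) :=
            r :- z :+ (:- con 1ℚ) :* (r :- (z :+ z :* (z :* e)))
                   :+ z :^ 2 :* e :* (w :+ con 1ℚ) :* (w :- con 1ℚ))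
          (λ _ → refl) Z E r one)
        (difference-zero r≐z+z²E) (difference-zero one≐𝟙)) n
  functional-equation n (suc k) = begin
    (z²kernel ⊛₂ S) n (suc k)
      ≡⟨ ⊛₂-suc-linear z²kernel S z²kernel-coeff₂₊ n k ⟩
    (coeffU 0 z²kernel ⊛ coeffU (suc k) S) n ℚ.+ (coeffU 1 z²kernel ⊛ coeffU k S) n
      ≡⟨ cong₂ ℚ._+_ (⊛-cong z²kernel-coeff₀ (coeffU-S≐levelSeries (suc k)) n)
                     (⊛-cong z²kernel-coeff₁ (coeffU-S≐levelSeries k) n) ⟩
    (Z ^ₛ 2 ⊛ one ⊛ levelSeries (suc k) ⊕ Z ^ₛ 2 ⊛ -ₛ q ⊛ levelSeries k) n
      ≡⟨ ≐-modulo₁ {R = 𝟘} {C = Z ^ₛ 2 ⊛ E ⊛ q ⊛ q ^ₛ k} {X = one ⊕ -ₛ 𝟙}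
           (solve 5 (λ z e q x w → z :^ 2 :* w :* (e :* (q :* x)) :+ z :^ 2 :* (:- q) :* (e :* x) :=
               con 0ℚ :+ z :^ 2 :* e :* q :* x :* (w :- con 1ℚ))
             (λ _ → refl) Z E q (q ^ₛ k) one)
           (difference-zero one≐𝟙) n ⟩
    𝟘 n
      ≡⟨ 𝟘≐0ₛ n ⟩
    0ℚ ∎
    where open ≡-Reasoning

mainTheorem15 :
    (∃ λ W → IsW W × ∃ λ r₁ → IsR1 W r₁)
    × (∀ W r₁ → IsW W → IsR1 W r₁ →
        (lift (Z ^ₛ 2) ⊛₂ (lift one ⊖₂ Uvar ⊛₂ lift (oneMinusZ ⊛ r₁)) ⊛₂ S
           ≐₂ lift (r₁ ⊖ Z))
        × (∀ (j : ℕ) → j ≥ 1 →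
             Z ^ₛ 2 ⊛ coeffU j S
               ≐ (oneMinusZ ^ₛ j) ⊛ (r₁ ^ₛ (j + 1))
                 ⊖ Z ⊛ (oneMinusZ ^ₛ j) ⊛ (r₁ ^ₛ j)))
mainTheorem15 = W-and-r₁-exist , λ W r₁ hW hR →
  let open RootSeries r₁ (IsR1⇒IsRoot W r₁ hW hR)
  in functional-equation , λ j _ → coefficient-formula j
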